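{- Let $(a,b)$ be a lexicographically nonincreasing list of pairs of nonnegative integers of length $n$ and let $(a',b)$ be a list such that $a$ is obtained from $a'$ by a unit $(i,j)$-transfer. Then $N_2(a,b)\ge N_2(a',b)$. If moreover $(a',b)$ is digraphic, then $N_2(a,b)>N_2(a',b)$.
   Context: $(a,b)$ denotes $((a_1,b_1),\dots,(a_n,b_n))$. It is lexicographically nonincreasing if $(a_i,b_i)\ge_{lex}(a_{i+1},b_{i+1})$ for all $i$, where $(x,y)\ge_{lex}(x',y')$ iff $x>x'$, or $x=x'$ and $y\ge y'$. A digraph realization of $(a,b)$ is a digraph without loops and without multiple arcs on labeled vertices $v_1,\dots,v_n$ with indegree $a_i$ and outdegree $b_i$ at $v_i$; $(a,b)$ is digraphic if one exists, and $N_2(a,b)$ is the number of digraph realizations ($0$ if none). Unit $(i,j)$-transfer: for $1\le i<j\le n$ with $a'_i\ge a'_j+2$, the list $a'-e_i+e_j$. -}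

module Defs where

open import Data.Nat using (ℕ; zero; suc; _+_; _≥_; _>_; _∸_; _≟_)
open import Data.Bool using (Bool; true; false)
open import Data.Fin using (Fin)
open import Data.Vec using (Vec; []; _∷_; lookup; updateAt; zip; toList)
open import Data.List using (List; []; _∷_; map; concatMap; filter; length; sum)
open import Data.List.Relation.Unary.Linked using (Linked)
open import Data.Product using (_×_; _,_; Σ)
open import Data.Sum using (_⊎_)
open import Relation.Binary.PropositionalEquality using (_≡_)
open import Relation.Nullary using (Dec; yes; no)
open import Relation.Nullary.Decidable using (_×-dec_)
open import Relation.Unary using (Decidable)
open import Data.Vec.Relation.Unary.All using (All; all?)
open import Data.Fin using () renaming (_≟_ to _≟ᶠ_)
open import Data.Bool using () renaming (_≟_ to _≟ᵇ_)

_≥lex_ : ℕ × ℕ → ℕ × ℕ → Set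
(x , y) ≥lex (x' , y') = (x > x') ⊎ ((x ≡ x') × (y ≥ y'))

LexNonincreasing : ∀ {n} → Vec ℕ n → Vec ℕ n → Set
LexNonincreasing a b = Linked _≥lex_ (toList (zip a b))

-- Unit (i,j)-transfer applied to a' : a' - e_i + e_j.
-- (The side conditions i < j and a'_i ≥ a'_j + 2 are stated separately.)
transfer : ∀ {n} → Fin n → Fin n → Vec ℕ n → Vec ℕ n
transfer i j a' = updateAt (updateAt a' i (λ x → x ∸ 1)) j suc

-- A digraph on labeled vertices v_1..v_n (no multiple arcs by construction):
-- adjacency matrix, D[u][v] = true iff there is an arc u → v.
Digraph : ℕ → Set
Digraph n = Vec (Vec Bool n) n

arc : ∀ {n} → Digraph n → Fin n → Fin n → Bool
arc D u v = lookup (lookup D u) v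

countTrue : List Bool → ℕ
countTrue [] = 0
countTrue (true ∷ bs) = suc (countTrue bs)
countTrue (false ∷ bs) = countTrue bs

allFinL : (n : ℕ) → List (Fin n)
allFinL zero = []
allFinL (suc n) = Fin.zero ∷ map Fin.suc (allFinL n)

outdeg : ∀ {n} → Digraph n → Fin n → ℕ
outdeg {n} D u = countTrue (map (arc D u) (allFinL n))

indeg : ∀ {n} → Digraph n → Fin n → ℕ
indeg {n} D v = countTrue (map (λ u → arc D u v) (allFinL n))

Realizes : ∀ {n} → Vec ℕ n → Vec ℕ n → Digraph n → Set
Realizes {n} a b D =
  (∀ (v : Fin n) → arc D v v ≡ false) ×
  (∀ (v : Fin n) → indeg D v ≡ lookup a v) ×
  (∀ (v : Fin n) → outdeg D v ≡ lookup b v)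

Digraphic : ∀ {n} → Vec ℕ n → Vec ℕ n → Set
Digraphic {n} a b = Σ (Digraph n) (Realizes a b)

allVecs : {A : Set} → List A → (m : ℕ) → List (Vec A m)
allVecs xs zero = [] ∷ []
allVecs xs (suc m) = concatMap (λ x → map (x ∷_) (allVecs xs m)) xs

allDigraphs : (n : ℕ) → List (Digraph n)
allDigraphs n = allVecs (allVecs (true ∷ false ∷ []) n) n

allFin? : ∀ {n} (P : Fin n → Set) → (∀ v → Dec (P v)) → Dec (∀ v → P v)
allFin? {zero} P d = yes (λ ())
allFin? {suc n} P d with d Fin.zero | allFin? (λ v → P (Fin.suc v)) (λ v → d (Fin.suc v))
... | yes p | yes q = yes λ { Fin.zero → p ; (Fin.suc v) → q v }
... | no ¬p | _ = no λ f → ¬p (f Fin.zero)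
... | _ | no ¬q = no λ f → ¬q (λ v → f (Fin.suc v))

realizes? : ∀ {n} (a b : Vec ℕ n) → Decidable (Realizes a b)
realizes? a b D =
  allFin? _ (λ v → arc D v v ≟ᵇ false) ×-dec
  (allFin? _ (λ v → indeg D v ≟ lookup a v) ×-dec
   allFin? _ (λ v → outdeg D v ≟ lookup b v))

N₂ : ∀ {n} → Vec ℕ n → Vec ℕ n → ℕ
N₂ {n} a b = length (filter (realizes? a b) (allDigraphs n))

-- Let M be a realization of (a′, b). Label each vertex u ∉ {i, j} up if u → i is an arc but u → j
-- is not, down in the opposite case, and rigid otherwise. Comparing the indegrees of i and j gives
-- a′ᵢ + M i j + #down = a′ⱼ + M j i + #up, so a′ᵢ ≥ a′ⱼ + 2 forces more ups than downs. Reading the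
-- downs as opening and the ups as closing brackets, redirect the arc u → i of the last unmatched up
-- to u → j. This realizes (a, b), and it is injective: the bracket operation is injective on label
-- words, and a row is recovered from its new entries and its label. Its images never have a ballot
-- label word (every suffix with at least as many ups as downs), while relabelling any realization of
-- (a, b) with #down ≤ #up yields one that has. Such a realization exists whenever (a′, b) is
-- digraphic; only when aᵢ = aⱼ does this need the lexicographic order, bⱼ ≤ bᵢ, to trade arcs
-- between the rows of i and j.

module Submission where

open import Level using (0ℓ)
open import Data.Nat using (ℕ; zero; suc; _+_; _∸_; _≤_; _≥_; _>_; z≤n; s≤s; _≤?_)
open import Data.Nat.Properties hiding (_≟_)
open import Data.Nat.Tactic.RingSolver using (solve-∀)
open import Data.Bool using (Bool; true; false; not)
import Data.Bool as Bool
open import Data.Fin using (Fin; _≟_; _<_) renaming (zero to fzero; suc to fsuc)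
open import Data.Fin.Properties using (punchInᵢ≢i; any?)
import Data.Fin.Properties as Fin
open import Data.Vec using (Vec; []; _∷_; lookup; tabulate; updateAt; zip; toList)
open import Data.Vec.Properties
  using (lookup∘tabulate; tabulate∘lookup; tabulate-cong; lookup∘updateAt; lookup∘updateAt′; lookup-zip)
import Data.Vec.Functional as Vector
open import Data.Vec.Functional.Properties using (updateAt-updates; updateAt-minimal)
open import Algebra.Properties.CommutativeMonoid.Sum +-0-commutativeMonoid
  using (sum; sum-cong-≗; ∑-distrib-+; sum-remove)
open import Data.Maybe using (Maybe; just; nothing; maybe′)
import Data.Maybe as Maybe
open import Data.List using (List; []; _∷_; map; filter; length; concatMap)
open import Data.List.Properties using (map-∘; length-map; length-removeAt′)
open import Data.List.Membership.Propositional using (_∈_; _∉_)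
open import Data.List.Membership.Propositional.Properties
  using (∈-map⁺; ∈-map⁻; ∈-filter⁺; ∈-concatMap⁺; ∈-concatMap⁻)
open import Data.List.Relation.Unary.Any using (here; there; _─_)
import Data.List.Relation.Unary.Any as Any
open import Data.List.Relation.Unary.All using (All; []; _∷_) renaming (lookup to All-lookup)
open import Data.List.Relation.Unary.All.Properties using (all-filter) renaming (map⁺ to All-map⁺)
open import Data.List.Relation.Unary.AllPairs using ([]; _∷_)
open import Data.List.Relation.Unary.Unique.Propositional using (Unique)
import Data.List.Relation.Unary.Unique.Propositional.Properties as Unique
open import Data.List.Relation.Unary.Linked using (Linked; _∷_)
open import Data.Product using (_×_; _,_; ∃-syntax; proj₁; proj₂)
open import Data.Sum using (inj₁; inj₂)
open import Data.Unit using (⊤; tt)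
open import Data.Empty using (⊥-elim)
open import Function using (_∘_; case_of_)
open import Relation.Nullary using (¬_; yes; no)
open import Relation.Nullary.Decidable using (_×-dec_)
open import Relation.Unary using (Pred; Decidable)
open import Relation.Binary using (Transitive)
open import Relation.Binary.PropositionalEquality

open import Defs

-- Words over rigid, up and down

data Letter : Set where
  rigid up down : Letter

#up : ∀ {m} → Vec Letter m → ℕ
#up [] = 0
#up (up ∷ w) = suc (#up w)
#up (_ ∷ w) = #up w

#down : ∀ {m} → Vec Letter m → ℕ
#down [] = 0
#down (down ∷ w) = suc (#down w)
#down (_ ∷ w) = #down w

isRigid : Letter → ℕ
isRigid rigid = 1
isRigid _ = 0

SameRigid : ∀ {m} → Vec Letter m → Vec Letter m → Set
SameRigid {m} v w = ∀ (p : Fin m) → isRigid (lookup v p) ≡ isRigid (lookup w p)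

Ballot : ∀ {m} → Vec Letter m → Set
Ballot [] = ⊤
Ballot (x ∷ w) = Ballot w × (#down (x ∷ w) ≤ #up (x ∷ w))

-- Reading down as an opening and up as a closing bracket, shift c w turns the
-- last unmatched up of w into a down, where c downs are still open on the left.
shift : ∀ {m} → ℕ → Vec Letter m → Maybe (Vec Letter m)
shift c [] = nothing
shift c (rigid ∷ w) = Maybe.map (rigid ∷_) (shift c w)
shift c (down ∷ w) = Maybe.map (down ∷_) (shift (suc c) w)
shift (suc c) (up ∷ w) = Maybe.map (up ∷_) (shift c w)
shift zero (up ∷ w) = just (maybe′ (up ∷_) (down ∷ w) (shift zero w))

shift-just : ∀ {m} c (w : Vec Letter m) → #up w > #down w + c → ∃[ v ] shift c w ≡ just v
shift-just c (rigid ∷ w) h with shift-just c w h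
... | v , eq rewrite eq = rigid ∷ v , refl
shift-just c (down ∷ w) h with shift-just (suc c) w (subst (#up w >_) (sym (+-suc (#down w) c)) h)
... | v , eq rewrite eq = down ∷ v , refl
shift-just zero (up ∷ w) h = _ , refl
shift-just (suc c) (up ∷ w) h with shift-just c w (≤-pred (subst (suc (#up w) >_) (+-suc (#down w) c) h))
... | v , eq rewrite eq = up ∷ v , refl

shift-nothing : ∀ {m} c (w : Vec Letter m) → shift c w ≡ nothing → #up w ≤ #down w + c
shift-nothing c w eq with #up w ≤? #down w + c
... | yes le = le
... | no ≰ with shift-just c w (≰⇒> ≰)
... | v , eq′ with () ← trans (sym eq) eq′

private
  map-just : ∀ {A B : Set} (f : A → B) (x : Maybe A) {y : B} →
             Maybe.map f x ≡ just y → ∃[ z ] x ≡ just z × y ≡ f z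
  map-just f (just z) refl = z , refl , refl

  step : ℕ → Letter → ℕ
  step c rigid = c
  step c down = suc c
  step zero up = zero
  step (suc c) up = c

  data ShiftView {m} (c : ℕ) (x : Letter) (w : Vec Letter m) : Vec Letter (suc m) → Set where
    passes : ∀ {v} → shift (step c x) w ≡ just v → ShiftView c x w (x ∷ v)
    flips : x ≡ up → c ≡ 0 → shift 0 w ≡ nothing → ShiftView c x w (down ∷ w)

  shiftView : ∀ {m} c x (w : Vec Letter m) {v} → shift c (x ∷ w) ≡ just v → ShiftView c x w v
  shiftView c rigid w e with map-just (rigid ∷_) (shift c w) e
  ... | _ , eq , refl = passes eq
  shiftView c down w e with map-just (down ∷_) (shift (suc c) w) e
  ... | _ , eq , refl = passes eq
  shiftView (suc c) up w e with map-just (up ∷_) (shift c w) e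
  ... | _ , eq , refl = passes eq
  shiftView zero up w e with shift zero w in eq
  shiftView zero up w refl | just _ = passes eq
  shiftView zero up w refl | nothing = flips refl refl eq

-- One more open down on the left can only delay the flip.
shift-suc-just : ∀ {m} c (w v : Vec Letter m) → shift (suc c) w ≡ just v → ∃[ v′ ] shift c v ≡ just v′
shift-suc-just c (x ∷ w) v e with shiftView (suc c) x w e
shift-suc-just c (rigid ∷ w) _ e | passes {v} eq with shift-suc-just c w v eq
... | v′ , eq′ rewrite eq′ = rigid ∷ v′ , refl
shift-suc-just c (down ∷ w) _ e | passes {v} eq with shift-suc-just (suc c) w v eq
... | v′ , eq′ rewrite eq′ = down ∷ v′ , refl
shift-suc-just zero (up ∷ w) _ e | passes {v} eq = _ , refl
shift-suc-just (suc c) (up ∷ w) _ e | passes {v} eq with shift-suc-just c w v eq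
... | v′ , eq′ rewrite eq′ = up ∷ v′ , refl

shift-injective : ∀ {m} c {w₁ w₂ v : Vec Letter m} → shift c w₁ ≡ just v → shift c w₂ ≡ just v → w₁ ≡ w₂
shift-injective c {[]} {[]} e₁ e₂ = refl
shift-injective c {x₁ ∷ w₁} {x₂ ∷ w₂} e₁ e₂ with shiftView c x₁ w₁ e₁ | shiftView c x₂ w₂ e₂
... | passes f₁ | passes f₂ = cong (x₁ ∷_) (shift-injective (step c x₁) f₁ f₂)
... | passes f₁ | flips refl refl n₂ with _ , f₁′ ← shift-suc-just 0 w₁ w₂ f₁ with () ← trans (sym n₂) f₁′
... | flips refl refl n₁ | passes f₂ with _ , f₂′ ← shift-suc-just 0 w₂ w₁ f₂ with () ← trans (sym n₁) f₂′
... | flips refl refl _ | flips refl refl _ = refl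

private
  sameRigid-∷ : ∀ {m} x y {v w : Vec Letter m} → isRigid x ≡ isRigid y → SameRigid v w → SameRigid (x ∷ v) (y ∷ w)
  sameRigid-∷ x y h s fzero = h
  sameRigid-∷ x y h s (fsuc p) = s p

shift-counts : ∀ {m} c (w v : Vec Letter m) → shift c w ≡ just v →
               SameRigid v w × suc (#up v) ≡ #up w × #down v ≡ suc (#down w)
shift-counts c (x ∷ w) _ e with shiftView c x w e
shift-counts c (x ∷ w) _ e | flips refl refl _ = sameRigid-∷ down up refl (λ _ → refl) , refl , refl
shift-counts c (rigid ∷ w) _ e | passes {v} eq with shift-counts c w v eq
... | s , u , d = sameRigid-∷ rigid rigid refl s , u , d
shift-counts c (down ∷ w) _ e | passes {v} eq with shift-counts (suc c) w v eq
... | s , u , d = sameRigid-∷ down down refl s , u , cong suc d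
shift-counts zero (up ∷ w) _ e | passes {v} eq with shift-counts zero w v eq
... | s , u , d = sameRigid-∷ up up refl s , cong suc u , d
shift-counts (suc c) (up ∷ w) _ e | passes {v} eq with shift-counts c w v eq
... | s , u , d = sameRigid-∷ up up refl s , cong suc u , d

shift-¬ballot : ∀ {m} c (w v : Vec Letter m) → shift c w ≡ just v → ¬ Ballot v
shift-¬ballot c (x ∷ w) _ e b with shiftView c x w e
... | passes {v} eq = shift-¬ballot (step c x) w v eq (proj₁ b)
... | flips refl refl n =
  <⇒≱ (s≤s (subst (#up w ≤_) (+-identityʳ (#down w)) (shift-nothing 0 w n))) (proj₂ b)

private
  downsThenUps : ∀ {m} → ℕ → Vec Letter m → Vec Letter m
  downsThenUps z [] = []
  downsThenUps z (rigid ∷ w) = rigid ∷ downsThenUps z w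
  downsThenUps zero (_ ∷ w) = up ∷ downsThenUps zero w
  downsThenUps (suc z) (_ ∷ w) = down ∷ downsThenUps z w

  downsThenUps-rigid : ∀ {m} z (w : Vec Letter m) → SameRigid (downsThenUps z w) w
  downsThenUps-rigid z [] ()
  downsThenUps-rigid z (rigid ∷ w) = sameRigid-∷ rigid rigid refl (downsThenUps-rigid z w)
  downsThenUps-rigid zero (up ∷ w) = sameRigid-∷ up up refl (downsThenUps-rigid zero w)
  downsThenUps-rigid zero (down ∷ w) = sameRigid-∷ up down refl (downsThenUps-rigid zero w)
  downsThenUps-rigid (suc z) (up ∷ w) = sameRigid-∷ down up refl (downsThenUps-rigid z w)
  downsThenUps-rigid (suc z) (down ∷ w) = sameRigid-∷ down down refl (downsThenUps-rigid z w)

  downsThenUps-total : ∀ {m} z (w : Vec Letter m) →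
                       #down (downsThenUps z w) + #up (downsThenUps z w) ≡ #down w + #up w
  downsThenUps-total z [] = refl
  downsThenUps-total z (rigid ∷ w) = downsThenUps-total z w
  downsThenUps-total zero (up ∷ w) =
    trans (+-suc _ _) (trans (cong suc (downsThenUps-total zero w)) (sym (+-suc _ _)))
  downsThenUps-total zero (down ∷ w) = trans (+-suc _ _) (cong suc (downsThenUps-total zero w))
  downsThenUps-total (suc z) (up ∷ w) = trans (cong suc (downsThenUps-total z w)) (sym (+-suc _ _))
  downsThenUps-total (suc z) (down ∷ w) = cong suc (downsThenUps-total z w)

  downsThenUps-#down : ∀ {m} z (w : Vec Letter m) → z ≤ #down w + #up w → #down (downsThenUps z w) ≡ z
  downsThenUps-#down zero [] _ = refl
  downsThenUps-#down z (rigid ∷ w) h = downsThenUps-#down z w h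
  downsThenUps-#down zero (up ∷ w) _ = downsThenUps-#down zero w z≤n
  downsThenUps-#down zero (down ∷ w) _ = downsThenUps-#down zero w z≤n
  downsThenUps-#down (suc z) (up ∷ w) h =
    cong suc (downsThenUps-#down z w (≤-pred (subst (suc z ≤_) (+-suc _ _) h)))
  downsThenUps-#down (suc z) (down ∷ w) h = cong suc (downsThenUps-#down z w (≤-pred h))

  downsThenUps-#down≤ : ∀ {m} z (w : Vec Letter m) → #down (downsThenUps z w) ≤ z
  downsThenUps-#down≤ z [] = z≤n
  downsThenUps-#down≤ z (rigid ∷ w) = downsThenUps-#down≤ z w
  downsThenUps-#down≤ zero (up ∷ w) = downsThenUps-#down≤ zero w
  downsThenUps-#down≤ zero (down ∷ w) = downsThenUps-#down≤ zero w
  downsThenUps-#down≤ (suc z) (up ∷ w) = s≤s (downsThenUps-#down≤ z w)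
  downsThenUps-#down≤ (suc z) (down ∷ w) = s≤s (downsThenUps-#down≤ z w)

  downsThenUps-ballot : ∀ {m} z (w : Vec Letter m) → z ≤ #up (downsThenUps z w) → Ballot (downsThenUps z w)
  downsThenUps-ballot z [] h = tt
  downsThenUps-ballot z (rigid ∷ w) h =
    downsThenUps-ballot z w h , ≤-trans (downsThenUps-#down≤ z w) h
  downsThenUps-ballot zero (up ∷ w) h =
    downsThenUps-ballot zero w z≤n , ≤-trans (downsThenUps-#down≤ zero w) z≤n
  downsThenUps-ballot zero (down ∷ w) h =
    downsThenUps-ballot zero w z≤n , ≤-trans (downsThenUps-#down≤ zero w) z≤n
  downsThenUps-ballot (suc z) (up ∷ w) h =
    downsThenUps-ballot z w (≤-trans (n≤1+n z) h) , ≤-trans (s≤s (downsThenUps-#down≤ z w)) h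
  downsThenUps-ballot (suc z) (down ∷ w) h =
    downsThenUps-ballot z w (≤-trans (n≤1+n z) h) , ≤-trans (s≤s (downsThenUps-#down≤ z w)) h

ballot-rearrangement : ∀ {m} (w : Vec Letter m) → #down w ≤ #up w →
  ∃[ v ] SameRigid v w × #down v ≡ #down w × #up v ≡ #up w × Ballot v
ballot-rearrangement w h =
  v , downsThenUps-rigid (#down w) w , #down-v , #up-v , downsThenUps-ballot (#down w) w (subst (#down w ≤_) (sym #up-v) h)
  where
  v = downsThenUps (#down w) w
  #down-v : #down v ≡ #down w
  #down-v = downsThenUps-#down (#down w) w (m≤m+n _ _)
  #up-v : #up v ≡ #up w
  #up-v = +-cancelˡ-≡ (#down w) _ _ (trans (cong (_+ #up v) (sym #down-v)) (downsThenUps-total (#down w) w))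

bit : Bool → ℕ
bit true = 1
bit false = 0

bit≤1 : ∀ b → bit b ≤ 1
bit≤1 true = s≤s z≤n
bit≤1 false = z≤n

countTrue≡sum : ∀ {n} (h : Fin n → Bool) → countTrue (map h (allFinL n)) ≡ sum (λ u → bit (h u))
countTrue≡sum {zero} h = refl
countTrue≡sum {suc n} h with h fzero
... | true = cong suc (trans (cong countTrue (sym (map-∘ (allFinL n)))) (countTrue≡sum (λ u → h (fsuc u))))
... | false = trans (cong countTrue (sym (map-∘ (allFinL n)))) (countTrue≡sum (λ u → h (fsuc u)))

sum-agreeing-off : ∀ {n} (k : Fin n) (f g : Fin n → ℕ) → (∀ u → u ≢ k → f u ≡ g u) →
                   sum f + g k ≡ sum g + f k
sum-agreeing-off {suc n} k f g h = begin
  sum f + g k                            ≡⟨ cong (_+ g k) (sum-remove {i = k} f) ⟩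
  f k + sum (Vector.removeAt f k) + g k  ≡⟨ cong (λ s → f k + s + g k) (sum-cong-≗ (λ u → h _ (punchInᵢ≢i k u))) ⟩
  f k + sum (Vector.removeAt g k) + g k  ≡⟨ exchange (f k) _ (g k) ⟩
  g k + sum (Vector.removeAt g k) + f k  ≡⟨ cong (_+ f k) (sum-remove {i = k} g) ⟨
  sum g + f k                            ∎
  where
  open ≡-Reasoning
  exchange : ∀ x s y → x + s + y ≡ y + s + x
  exchange = solve-∀

sum-agreeing-off₂ : ∀ {n} (i j : Fin n) (f g : Fin n → ℕ) → i ≢ j → (∀ u → u ≢ i → u ≢ j → f u ≡ g u) →
                    sum f + g i + g j ≡ sum g + f i + f j
sum-agreeing-off₂ i j f g i≢j h = begin
  sum f + g i + g j  ≡⟨ cong (λ x → sum f + x + g j) (updateAt-updates i f) ⟨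
  sum f + f′ i + g j ≡⟨ cong (_+ g j) (sum-agreeing-off i f f′ (λ u u≢i → sym (updateAt-minimal u i f u≢i))) ⟩
  sum f′ + f i + g j ≡⟨ exchange (sum f′) (f i) (g j) ⟩
  sum f′ + g j + f i ≡⟨ cong (_+ f i) (sum-agreeing-off j f′ g f′≐g) ⟩
  sum g + f′ j + f i ≡⟨ cong (λ x → sum g + x + f i) (updateAt-minimal j i f (i≢j ∘ sym)) ⟩
  sum g + f j + f i  ≡⟨ exchange (sum g) (f j) (f i) ⟩
  sum g + f i + f j  ∎
  where
  open ≡-Reasoning
  f′ : Fin _ → ℕ
  f′ = Vector.updateAt f i (λ _ → g i)
  f′≐g : ∀ u → u ≢ j → f′ u ≡ g u
  f′≐g u u≢j with u ≟ i
  ... | yes refl = updateAt-updates i f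
  ... | no u≢i = trans (updateAt-minimal u i f u≢i) (h u u≢i u≢j)
  exchange : ∀ x y z → x + y + z ≡ x + z + y
  exchange = solve-∀

sum-mono-≤ : ∀ {n} {f g : Fin n → ℕ} → (∀ u → f u ≤ g u) → sum f ≤ sum g
sum-mono-≤ {zero} h = z≤n
sum-mono-≤ {suc n} h = +-mono-≤ (h fzero) (sum-mono-≤ (λ u → h (fsuc u)))

sum-mono-< : ∀ {n} {f g : Fin n → ℕ} (k : Fin n) → (∀ u → f u ≤ g u) → g k > f k → sum g > sum f
sum-mono-< {suc n} fzero h hk = +-mono-<-≤ hk (sum-mono-≤ (λ u → h (fsuc u)))
sum-mono-< {suc n} (fsuc k) h hk = +-mono-≤-< (h fzero) (sum-mono-< k (λ u → h (fsuc u)) hk)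

sum-cong-off₂ : ∀ {n} {i j : Fin n} {f g : Fin n → ℕ} → i ≢ j → (∀ u → u ≢ i → u ≢ j → f u ≡ g u) →
                f i + f j ≡ g i + g j → sum f ≡ sum g
sum-cong-off₂ {i = i} {j} {f} {g} i≢j h eq = +-cancelʳ-≡ (g i + g j) (sum f) (sum g) (begin
  sum f + (g i + g j)  ≡⟨ +-assoc (sum f) (g i) (g j) ⟨
  sum f + g i + g j    ≡⟨ sum-agreeing-off₂ i j f g i≢j h ⟩
  sum g + f i + f j    ≡⟨ +-assoc (sum g) (f i) (f j) ⟩
  sum g + (f i + f j)  ≡⟨ cong (sum g +_) eq ⟩
  sum g + (g i + g j)  ∎)
  where open ≡-Reasoning

sum-bit-≤⇒∃ : ∀ {n} (r s : Fin n → Bool) {k} → r k ≡ false → s k ≡ true →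
              sum (λ v → bit (s v)) ≤ sum (λ v → bit (r v)) → ∃[ w ] r w ≡ true × s w ≡ false
sum-bit-≤⇒∃ r s {k} rk sk s≤r with any? (λ w → (r w Bool.≟ true) ×-dec (s w Bool.≟ false))
... | yes found = found
... | no none = ⊥-elim (<⇒≱ (sum-mono-< k pointwise strict) s≤r)
  where
  pointwise : ∀ v → bit (r v) ≤ bit (s v)
  pointwise v with r v in rv | s v in sv
  ... | true | true = s≤s z≤n
  ... | true | false = ⊥-elim (none (v , rv , sv))
  ... | false | _ = z≤n
  strict : bit (s k) > bit (r k)
  strict rewrite rk | sk = s≤s z≤n

Matrix : ℕ → Set
Matrix n = Fin n → Fin n → Bool

_≐_ : ∀ {n} → Matrix n → Matrix n → Set
M ≐ N = ∀ u v → M u v ≡ N u v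

toDigraph : ∀ {n} → Matrix n → Digraph n
toDigraph M = tabulate (λ u → tabulate (M u))

arc-toDigraph : ∀ {n} (M : Matrix n) → arc (toDigraph M) ≐ M
arc-toDigraph M u v rewrite lookup∘tabulate (λ u → tabulate (M u)) u = lookup∘tabulate (M u) v

toDigraph-arc : ∀ {n} (D : Digraph n) → toDigraph (arc D) ≡ D
toDigraph-arc D = trans (tabulate-cong (λ u → tabulate∘lookup (lookup D u))) (tabulate∘lookup D)

digraph-ext : ∀ {n} {D₁ D₂ : Digraph n} → arc D₁ ≐ arc D₂ → D₁ ≡ D₂
digraph-ext {D₁ = D₁} {D₂} eq = begin
  D₁                   ≡⟨ toDigraph-arc D₁ ⟨
  toDigraph (arc D₁)   ≡⟨ tabulate-cong (λ u → tabulate-cong (eq u)) ⟩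
  toDigraph (arc D₂)   ≡⟨ toDigraph-arc D₂ ⟩
  D₂                   ∎
  where open ≡-Reasoning

record MatRealizes {n} (a b : Vec ℕ n) (M : Matrix n) : Set where
  field
    loopless  : ∀ v → M v v ≡ false
    indegree  : ∀ v → sum (λ u → bit (M u v)) ≡ lookup a v
    outdegree : ∀ u → sum (λ v → bit (M u v)) ≡ lookup b u

realizes⇒matRealizes : ∀ {n} {a b : Vec ℕ n} {D} → Realizes a b D → MatRealizes a b (arc D)
realizes⇒matRealizes {D = D} (loopless , indeg≡ , outdeg≡) = record
  { loopless  = loopless
  ; indegree  = λ v → trans (sym (countTrue≡sum (λ u → arc D u v))) (indeg≡ v)
  ; outdegree = λ u → trans (sym (countTrue≡sum (arc D u))) (outdeg≡ u)
  }

matRealizes⇒realizes : ∀ {n} {a b : Vec ℕ n} {M} → MatRealizes a b M → Realizes a b (toDigraph M)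
matRealizes⇒realizes {M = M} r =
  (λ v → trans (arc-toDigraph M v v) (loopless v)) ,
  (λ v → trans (countTrue≡sum (λ u → arc (toDigraph M) u v)) (trans (sum-cong-≗ (λ u → cong bit (arc-toDigraph M u v))) (indegree v))) ,
  (λ u → trans (countTrue≡sum (arc (toDigraph M) u)) (trans (sum-cong-≗ (λ v → cong bit (arc-toDigraph M u v))) (outdegree u)))
  where open MatRealizes r

MatRealizes-cong : ∀ {n} {a₁ a₂ b : Vec ℕ n} {M} → (∀ v → lookup a₁ v ≡ lookup a₂ v) →
                   MatRealizes a₁ b M → MatRealizes a₂ b M
MatRealizes-cong eq r = record
  { loopless = loopless ; indegree = λ v → trans (indegree v) (eq v) ; outdegree = outdegree }
  where open MatRealizes r

module _ {n} {x y : Fin n} (x≢y : x ≢ y) (a : Vec ℕ n) where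

  private
    a⁻ : Vec ℕ n
    a⁻ = updateAt a x (λ d → d ∸ 1)

  lookup-transfer-source : lookup (transfer x y a) x ≡ lookup a x ∸ 1
  lookup-transfer-source = trans (lookup∘updateAt′ x y x≢y a⁻) (lookup∘updateAt x a)

  lookup-transfer-target : lookup (transfer x y a) y ≡ suc (lookup a y)
  lookup-transfer-target = trans (lookup∘updateAt y a⁻) (cong suc (lookup∘updateAt′ y x (x≢y ∘ sym) a))

  lookup-transfer-other : ∀ v → v ≢ x → v ≢ y → lookup (transfer x y a) v ≡ lookup a v
  lookup-transfer-other v v≢x v≢y = trans (lookup∘updateAt′ v y v≢y a⁻) (lookup∘updateAt′ v x v≢x a)

moveArc : ∀ {n} → Fin n → Fin n → Fin n → Matrix n → Matrix n
moveArc u x y M = Vector.updateAt M u (λ row → Vector.updateAt (Vector.updateAt row x (λ _ → false)) y (λ _ → true))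

module _ {n} {u x y : Fin n} {M : Matrix n} where

  private
    row : Fin n → Bool
    row = Vector.updateAt (M u) x (λ _ → false)

  moveArc-otherRow : ∀ {v} z → v ≢ u → moveArc u x y M v z ≡ M v z
  moveArc-otherRow z v≢u = cong-app (updateAt-minimal _ u M v≢u) z

  moveArc-target : moveArc u x y M u y ≡ true
  moveArc-target = trans (cong-app (updateAt-updates u M) y) (updateAt-updates y row)

  moveArc-source : x ≢ y → moveArc u x y M u x ≡ false
  moveArc-source x≢y =
    trans (cong-app (updateAt-updates u M) x) (trans (updateAt-minimal x y row x≢y) (updateAt-updates x (M u)))

  moveArc-otherColumn : ∀ {z} → z ≢ x → z ≢ y → moveArc u x y M u z ≡ M u z
  moveArc-otherColumn z≢x z≢y =
    trans (cong-app (updateAt-updates u M) _) (trans (updateAt-minimal _ y row z≢y) (updateAt-minimal _ x (M u) z≢x))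

moveArc-realizes : ∀ {n} {a b : Vec ℕ n} {M} {u x y} → MatRealizes a b M →
                   M u x ≡ true → M u y ≡ false → u ≢ y → MatRealizes (transfer x y a) b (moveArc u x y M)
moveArc-realizes {n} {a} {b} {M} {u} {x} {y} r ux uy u≢y = record
  { loopless = loopless′ ; indegree = indegree′ ; outdegree = outdegree′ }
  where
  open MatRealizes r
  M′ = moveArc u x y M

  x≢y : x ≢ y
  x≢y refl = case trans (sym ux) uy of λ ()
  u≢x : u ≢ x
  u≢x refl = case trans (sym ux) (loopless u) of λ ()

  loopless′ : ∀ v → M′ v v ≡ false
  loopless′ v with v ≟ u
  ... | yes refl = trans (moveArc-otherColumn u≢x u≢y) (loopless u)
  ... | no v≢u = trans (moveArc-otherRow v v≢u) (loopless v)

  swapped : bit (M′ u x) + bit (M′ u y) ≡ bit (M u x) + bit (M u y)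
  swapped = trans (cong₂ (λ p q → bit p + bit q) (moveArc-source x≢y) (moveArc-target {u = u} {x} {y} {M}))
                  (sym (cong₂ (λ p q → bit p + bit q) ux uy))

  outdegree′ : ∀ v → sum (λ z → bit (M′ v z)) ≡ lookup b v
  outdegree′ v with v ≟ u
  ... | yes refl = trans (sum-cong-off₂ x≢y (λ z z≢x z≢y → cong bit (moveArc-otherColumn z≢x z≢y)) swapped) (outdegree u)
  ... | no v≢u = trans (sum-cong-≗ (λ z → cong bit (moveArc-otherRow z v≢u))) (outdegree v)

  column : ∀ z → (∀ v → v ≢ u → bit (M′ v z) ≡ bit (M v z)) →
           sum (λ v → bit (M′ v z)) + bit (M u z) ≡ lookup a z + bit (M′ u z)
  column z h = trans (sum-agreeing-off u _ _ h) (cong (_+ bit (M′ u z)) (indegree z))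

  indegree′ : ∀ z → sum (λ v → bit (M′ v z)) ≡ lookup (transfer x y a) z
  indegree′ z with z ≟ x | z ≟ y
  ... | yes refl | _ = begin
    s                              ≡⟨ m+n∸n≡m s 1 ⟨
    s + 1 ∸ 1                      ≡⟨ cong (λ t → s + t ∸ 1) (cong bit ux) ⟨
    s + bit (M u x) ∸ 1            ≡⟨ cong (_∸ 1) (column x (λ v v≢u → cong bit (moveArc-otherRow x v≢u))) ⟩
    lookup a x + bit (M′ u x) ∸ 1  ≡⟨ cong (λ t → lookup a x + bit t ∸ 1) (moveArc-source x≢y) ⟩
    lookup a x + 0 ∸ 1             ≡⟨ cong (_∸ 1) (+-identityʳ (lookup a x)) ⟩
    lookup a x ∸ 1                 ≡⟨ lookup-transfer-source x≢y a ⟨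
    lookup (transfer x y a) x      ∎
    where
    open ≡-Reasoning
    s = sum (λ v → bit (M′ v x))
  ... | no z≢x | yes refl = begin
    s                          ≡⟨ +-identityʳ s ⟨
    s + 0                      ≡⟨ cong (λ t → s + bit t) uy ⟨
    s + bit (M u y)            ≡⟨ column y (λ v v≢u → cong bit (moveArc-otherRow y v≢u)) ⟩
    lookup a y + bit (M′ u y)  ≡⟨ cong (λ t → lookup a y + bit t) (moveArc-target {u = u} {x} {y} {M}) ⟩
    lookup a y + 1             ≡⟨ +-comm (lookup a y) 1 ⟩
    suc (lookup a y)           ≡⟨ lookup-transfer-target x≢y a ⟨
    lookup (transfer x y a) y  ∎
    where
    open ≡-Reasoning
    s = sum (λ v → bit (M′ v y))
  ... | no z≢x | no z≢y = trans (sum-cong-≗ unchanged) (trans (indegree z) (sym (lookup-transfer-other x≢y a z z≢x z≢y)))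
    where
    unchanged : ∀ v → bit (M′ v z) ≡ bit (M v z)
    unchanged v with v ≟ u
    ... | yes refl = cong bit (moveArc-otherColumn z≢x z≢y)
    ... | no v≢u = cong bit (moveArc-otherRow z v≢u)

transfer-trans : ∀ {n} {x y z : Fin n} → x ≢ y → y ≢ z → x ≢ z → ∀ (a : Vec ℕ n) v →
                 lookup (transfer y z (transfer x y a)) v ≡ lookup (transfer x z a) v
transfer-trans {x = x} {y} {z} x≢y y≢z x≢z a v with v ≟ x | v ≟ y | v ≟ z
... | yes refl | _ | _ = begin
  lookup (transfer y z (transfer x y a)) x  ≡⟨ lookup-transfer-other y≢z (transfer x y a) x x≢y x≢z ⟩
  lookup (transfer x y a) x                 ≡⟨ lookup-transfer-source x≢y a ⟩
  lookup a x ∸ 1                            ≡⟨ lookup-transfer-source x≢z a ⟨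
  lookup (transfer x z a) x                 ∎
  where open ≡-Reasoning
... | no _ | yes refl | _ = begin
  lookup (transfer y z (transfer x y a)) y  ≡⟨ lookup-transfer-source y≢z (transfer x y a) ⟩
  lookup (transfer x y a) y ∸ 1             ≡⟨ cong (_∸ 1) (lookup-transfer-target x≢y a) ⟩
  lookup a y                                ≡⟨ lookup-transfer-other x≢z a y (x≢y ∘ sym) y≢z ⟨
  lookup (transfer x z a) y                 ∎
  where open ≡-Reasoning
... | no z≢x | no _ | yes refl = begin
  lookup (transfer y z (transfer x y a)) z  ≡⟨ lookup-transfer-target y≢z (transfer x y a) ⟩
  suc (lookup (transfer x y a) z)           ≡⟨ cong suc (lookup-transfer-other x≢y a z z≢x (y≢z ∘ sym)) ⟩
  suc (lookup a z)                          ≡⟨ lookup-transfer-target x≢z a ⟨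
  lookup (transfer x z a) z                 ∎
  where open ≡-Reasoning
... | no v≢x | no v≢y | no v≢z = begin
  lookup (transfer y z (transfer x y a)) v  ≡⟨ lookup-transfer-other y≢z (transfer x y a) v v≢y v≢z ⟩
  lookup (transfer x y a) v                 ≡⟨ lookup-transfer-other x≢y a v v≢x v≢y ⟩
  lookup a v                                ≡⟨ lookup-transfer-other x≢z a v v≢x v≢z ⟨
  lookup (transfer x z a) v                 ∎
  where open ≡-Reasoning

-- Labelling and redirecting the arcs into i and j

isUp : Letter → ℕ
isUp up = 1
isUp _ = 0

isDown : Letter → ℕ
isDown down = 1
isDown _ = 0

sum-isUp : ∀ {m} (w : Vec Letter m) → sum (λ p → isUp (lookup w p)) ≡ #up w
sum-isUp [] = refl
sum-isUp (rigid ∷ w) = sum-isUp w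
sum-isUp (up ∷ w) = cong suc (sum-isUp w)
sum-isUp (down ∷ w) = sum-isUp w

sum-isDown : ∀ {m} (w : Vec Letter m) → sum (λ p → isDown (lookup w p)) ≡ #down w
sum-isDown [] = refl
sum-isDown (rigid ∷ w) = sum-isDown w
sum-isDown (up ∷ w) = sum-isDown w
sum-isDown (down ∷ w) = cong suc (sum-isDown w)

letter : Bool → Bool → Letter
letter true false = up
letter false true = down
letter true true = rigid
letter false false = rigid

dir : Bool → Letter
dir true = up
dir false = down

letter≡dir : ∀ x y b → letter x y ≡ dir b → x ≡ b × y ≡ not b
letter≡dir true false true refl = refl , refl
letter≡dir false true false refl = refl , refl
letter≡dir true true true ()
letter≡dir true true false ()
letter≡dir false false true ()
letter≡dir false false false ()
letter≡dir true false false ()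
letter≡dir false true true ()

letter-balance : ∀ x y → bit x + isDown (letter x y) ≡ bit y + isUp (letter x y)
letter-balance true false = refl
letter-balance false true = refl
letter-balance true true = refl
letter-balance false false = refl

-- The new entries in columns i and j of a row relabelled by the given letter.
atI : Letter → Bool → Bool
atI rigid x = x
atI up _ = true
atI down _ = false

atJ : Letter → Bool → Bool
atJ rigid y = y
atJ up _ = false
atJ down _ = true

module Relabelling {n} (i j : Fin n) (i≢j : i ≢ j) where

  data Position (v : Fin n) : Set where
    is-i : v ≡ i → Position v
    is-j : v ≡ j → Position v
    elsewhere : v ≢ i → v ≢ j → Position v

  position : ∀ v → Position v
  position v with v ≟ i | v ≟ j
  ... | yes v≡i | _ = is-i v≡i
  ... | no _ | yes v≡j = is-j v≡j
  ... | no v≢i | no v≢j = elsewhere v≢i v≢j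

  label : Matrix n → Fin n → Letter
  label M u with u ≟ i | u ≟ j
  ... | no _ | no _ = letter (M u i) (M u j)
  ... | _ | _ = rigid

  labels : Matrix n → Vec Letter n
  labels M = tabulate (label M)

  lookup-labels : ∀ M u → lookup (labels M) u ≡ label M u
  lookup-labels M = lookup∘tabulate (label M)

  label-i : ∀ M → label M i ≡ rigid
  label-i M with i ≟ i
  ... | yes _ = refl
  ... | no i≢i = ⊥-elim (i≢i refl)

  label-j : ∀ M → label M j ≡ rigid
  label-j M with j ≟ i | j ≟ j
  ... | yes _ | _ = refl
  ... | no _ | yes _ = refl
  ... | no _ | no j≢j = ⊥-elim (j≢j refl)

  label-inner : ∀ M {u} → u ≢ i → u ≢ j → label M u ≡ letter (M u i) (M u j)
  label-inner M {u} u≢i u≢j with u ≟ i | u ≟ j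
  ... | yes u≡i | _ = ⊥-elim (u≢i u≡i)
  ... | no _ | yes u≡j = ⊥-elim (u≢j u≡j)
  ... | no _ | no _ = refl

  label≡dir : ∀ M {u} b → label M u ≡ dir b → u ≢ i × u ≢ j × M u i ≡ b × M u j ≡ not b
  label≡dir M {u} b e with u ≟ i | u ≟ j
  ... | no u≢i | no u≢j = u≢i , u≢j , letter≡dir (M u i) (M u j) b e
  label≡dir M {u} true () | yes _ | _
  label≡dir M {u} false () | yes _ | _
  label≡dir M {u} true () | no _ | yes _
  label≡dir M {u} false () | no _ | yes _

  label-cong : ∀ {M N} u → M u i ≡ N u i → M u j ≡ N u j → label M u ≡ label N u
  label-cong u ei ej with u ≟ i | u ≟ j
  ... | no _ | no _ = cong₂ letter ei ej
  ... | yes _ | _ = refl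
  ... | no _ | yes _ = refl

  labels-cong : ∀ {M N} → M ≐ N → labels M ≡ labels N
  labels-cong eq = tabulate-cong (λ u → label-cong u (eq u i) (eq u j))

  sum-isUp-labels : ∀ M → sum (λ u → isUp (label M u)) ≡ #up (labels M)
  sum-isUp-labels M = trans (sum-cong-≗ (λ u → cong isUp (sym (lookup-labels M u)))) (sum-isUp (labels M))

  sum-isDown-labels : ∀ M → sum (λ u → isDown (label M u)) ≡ #down (labels M)
  sum-isDown-labels M = trans (sum-cong-≗ (λ u → cong isDown (sym (lookup-labels M u)))) (sum-isDown (labels M))

  -- Each row u outside {i, j} satisfies M u i + [u is down] = M u j + [u is up].
  indegree-balance : ∀ {a b M} → MatRealizes a b M →
    lookup a i + bit (M i j) + #down (labels M) ≡ lookup a j + bit (M j i) + #up (labels M)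
  indegree-balance {a} {b} {M} r = begin
    lookup a i + bit (M i j) + #down (labels M)      ≡⟨ rearrange (lookup a i) _ _ ⟩
    lookup a i + #down (labels M) + bit (M i j) + 0  ≡⟨ cong₂ (λ s x → s + x + 0) sum-f g-i ⟨
    sum f + g i + 0                                  ≡⟨ cong (sum f + g i +_) g-j ⟨
    sum f + g i + g j                                ≡⟨ sum-agreeing-off₂ i j f g i≢j inner ⟩
    sum g + f i + f j                                ≡⟨ cong₂ (λ s x → s + x + f j) sum-g f-i ⟩
    lookup a j + #up (labels M) + 0 + f j            ≡⟨ cong (lookup a j + #up (labels M) + 0 +_) f-j ⟩
    lookup a j + #up (labels M) + 0 + bit (M j i)    ≡⟨ rearrange′ (lookup a j) _ _ ⟨
    lookup a j + bit (M j i) + #up (labels M)        ∎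
    where
    open ≡-Reasoning
    open MatRealizes r
    f g : Fin n → ℕ
    f u = bit (M u i) + isDown (label M u)
    g u = bit (M u j) + isUp (label M u)
    sum-f : sum f ≡ lookup a i + #down (labels M)
    sum-f = trans (∑-distrib-+ (λ u → bit (M u i)) (λ u → isDown (label M u))) (cong₂ _+_ (indegree i) (sum-isDown-labels M))
    sum-g : sum g ≡ lookup a j + #up (labels M)
    sum-g = trans (∑-distrib-+ (λ u → bit (M u j)) (λ u → isUp (label M u))) (cong₂ _+_ (indegree j) (sum-isUp-labels M))
    inner : ∀ u → u ≢ i → u ≢ j → f u ≡ g u
    inner u u≢i u≢j rewrite label-inner M u≢i u≢j = letter-balance (M u i) (M u j)
    f-i : f i ≡ 0
    f-i rewrite label-i M | loopless i = refl
    f-j : f j ≡ bit (M j i)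
    f-j rewrite label-j M = +-identityʳ _
    g-i : g i ≡ bit (M i j)
    g-i rewrite label-i M = +-identityʳ _
    g-j : g j ≡ 0
    g-j rewrite label-j M | loopless j = refl
    rearrange : ∀ x y z → x + y + z ≡ x + z + y + 0
    rearrange = solve-∀
    rearrange′ : ∀ x y z → x + y + z ≡ x + z + 0 + y
    rearrange′ = solve-∀

  redirect : Vec Letter n → Matrix n → Matrix n
  redirect w M u v with v ≟ i | v ≟ j
  ... | yes _ | _ = atI (lookup w u) (M u v)
  ... | no _ | yes _ = atJ (lookup w u) (M u v)
  ... | no _ | no _ = M u v

  redirect-i : ∀ w M u → redirect w M u i ≡ atI (lookup w u) (M u i)
  redirect-i w M u with i ≟ i
  ... | yes _ = refl
  ... | no i≢i = ⊥-elim (i≢i refl)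

  redirect-j : ∀ w M u → redirect w M u j ≡ atJ (lookup w u) (M u j)
  redirect-j w M u with j ≟ i | j ≟ j
  ... | yes j≡i | _ = ⊥-elim (i≢j (sym j≡i))
  ... | no _ | yes _ = refl
  ... | no _ | no j≢j = ⊥-elim (j≢j refl)

  redirect-other : ∀ w M u {v} → v ≢ i → v ≢ j → redirect w M u v ≡ M u v
  redirect-other w M u {v} v≢i v≢j with v ≟ i | v ≟ j
  ... | yes v≡i | _ = ⊥-elim (v≢i v≡i)
  ... | no _ | yes v≡j = ⊥-elim (v≢j v≡j)
  ... | no _ | no _ = refl

  redirect-rigidRow : ∀ w M {u} → lookup w u ≡ rigid → redirect w M u i ≡ M u i × redirect w M u j ≡ M u j
  redirect-rigidRow w M {u} wu =
    trans (redirect-i w M u) (cong (λ ℓ → atI ℓ (M u i)) wu) , trans (redirect-j w M u) (cong (λ ℓ → atJ ℓ (M u j)) wu)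

  rigid-letter : ∀ {w M} → SameRigid w (labels M) → ∀ u → label M u ≡ rigid → lookup w u ≡ rigid
  rigid-letter {M = M} s u ℓu = isRigid≡1 (trans (s u) (cong isRigid (trans (lookup-labels M u) ℓu)))
    where
    isRigid≡1 : ∀ {ℓ} → isRigid ℓ ≡ 1 → ℓ ≡ rigid
    isRigid≡1 {rigid} _ = refl

  data RowView (w : Vec Letter n) (M : Matrix n) (u : Fin n) : Set where
    kept  : lookup w u ≡ rigid → label M u ≡ rigid → RowView w M u
    moved : ∀ b b′ → u ≢ i → u ≢ j → M u i ≡ b → M u j ≡ not b → lookup w u ≡ dir b′ → RowView w M u

  movedRow : ∀ {w M u} b b′ → lookup w u ≡ dir b′ → label M u ≡ dir b → RowView w M u
  movedRow {M = M} b b′ wu ℓu with u≢i , u≢j , ui , uj ← label≡dir M b ℓu = moved b b′ u≢i u≢j ui uj wu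

  rowView : ∀ {w M} → SameRigid w (labels M) → ∀ u → RowView w M u
  rowView {w} {M} s u with lookup w u in wu | label M u in ℓu | trans (s u) (cong isRigid (lookup-labels M u))
  ... | rigid | rigid | _ = kept wu ℓu
  ... | up | up | _ = movedRow true true wu ℓu
  ... | up | down | _ = movedRow false true wu ℓu
  ... | down | up | _ = movedRow true false wu ℓu
  ... | down | down | _ = movedRow false false wu ℓu

  module _ {w M} (s : SameRigid w (labels M)) where

    redirect-cell-i : ∀ u → bit (redirect w M u i) + isUp (label M u) ≡ bit (M u i) + isUp (lookup w u)
    redirect-cell-i u rewrite redirect-i w M u with rowView {w} {M} s u
    ... | kept wu ℓu rewrite wu | ℓu = refl
    ... | moved b b′ u≢i u≢j ui uj wu rewrite wu | label-inner M u≢i u≢j | ui | uj with b | b′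
    ... | true | true = refl
    ... | true | false = refl
    ... | false | true = refl
    ... | false | false = refl

    redirect-cell-j : ∀ u → bit (redirect w M u j) + isDown (label M u) ≡ bit (M u j) + isDown (lookup w u)
    redirect-cell-j u rewrite redirect-j w M u with rowView {w} {M} s u
    ... | kept wu ℓu rewrite wu | ℓu = refl
    ... | moved b b′ u≢i u≢j ui uj wu rewrite wu | label-inner M u≢i u≢j | ui | uj with b | b′
    ... | true | true = refl
    ... | true | false = refl
    ... | false | true = refl
    ... | false | false = refl

    redirect-cell-row : ∀ u → bit (redirect w M u i) + bit (redirect w M u j) ≡ bit (M u i) + bit (M u j)
    redirect-cell-row u rewrite redirect-i w M u | redirect-j w M u with rowView {w} {M} s u
    ... | kept wu _ rewrite wu = refl
    ... | moved b b′ _ _ ui uj wu rewrite wu | ui | uj with b | b′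
    ... | true | true = refl
    ... | true | false = refl
    ... | false | true = refl
    ... | false | false = refl

    label-redirect : ∀ u → label (redirect w M) u ≡ lookup w u
    label-redirect u with rowView {w} {M} s u
    ... | kept wu ℓu =
      let rᵢ , rⱼ = redirect-rigidRow w M wu in trans (label-cong u rᵢ rⱼ) (trans ℓu (sym wu))
    ... | moved b b′ u≢i u≢j _ _ wu
      rewrite label-inner (redirect w M) u≢i u≢j | redirect-i w M u | redirect-j w M u | wu with b′
    ... | true = refl
    ... | false = refl

    labels-redirect : labels (redirect w M) ≡ w
    labels-redirect = trans (tabulate-cong label-redirect) (tabulate∘lookup w)

    redirect-ij : redirect w M i j ≡ M i j
    redirect-ij = proj₂ (redirect-rigidRow w M (rigid-letter {w} {M} s i (label-i M)))

    redirect-ji : redirect w M j i ≡ M j i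
    redirect-ji = proj₁ (redirect-rigidRow w M (rigid-letter {w} {M} s j (label-j M)))

    column-i : sum (λ u → bit (redirect w M u i)) + #up (labels M) ≡ sum (λ u → bit (M u i)) + #up w
    column-i = begin
      sum (λ u → bit (redirect w M u i)) + #up (labels M)
        ≡⟨ cong (sum (λ u → bit (redirect w M u i)) +_) (sum-isUp-labels M) ⟨
      sum (λ u → bit (redirect w M u i)) + sum (λ u → isUp (label M u))
        ≡⟨ ∑-distrib-+ (λ u → bit (redirect w M u i)) (λ u → isUp (label M u)) ⟨
      sum (λ u → bit (redirect w M u i) + isUp (label M u))
        ≡⟨ sum-cong-≗ redirect-cell-i ⟩
      sum (λ u → bit (M u i) + isUp (lookup w u))
        ≡⟨ ∑-distrib-+ (λ u → bit (M u i)) (λ u → isUp (lookup w u)) ⟩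
      sum (λ u → bit (M u i)) + sum (λ u → isUp (lookup w u))
        ≡⟨ cong (sum (λ u → bit (M u i)) +_) (sum-isUp w) ⟩
      sum (λ u → bit (M u i)) + #up w ∎
      where open ≡-Reasoning

    column-j : sum (λ u → bit (redirect w M u j)) + #down (labels M) ≡ sum (λ u → bit (M u j)) + #down w
    column-j = begin
      sum (λ u → bit (redirect w M u j)) + #down (labels M)
        ≡⟨ cong (sum (λ u → bit (redirect w M u j)) +_) (sum-isDown-labels M) ⟨
      sum (λ u → bit (redirect w M u j)) + sum (λ u → isDown (label M u))
        ≡⟨ ∑-distrib-+ (λ u → bit (redirect w M u j)) (λ u → isDown (label M u)) ⟨
      sum (λ u → bit (redirect w M u j) + isDown (label M u))
        ≡⟨ sum-cong-≗ redirect-cell-j ⟩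
      sum (λ u → bit (M u j) + isDown (lookup w u))
        ≡⟨ ∑-distrib-+ (λ u → bit (M u j)) (λ u → isDown (lookup w u)) ⟩
      sum (λ u → bit (M u j)) + sum (λ u → isDown (lookup w u))
        ≡⟨ cong (sum (λ u → bit (M u j)) +_) (sum-isDown w) ⟩
      sum (λ u → bit (M u j)) + #down w ∎
      where open ≡-Reasoning

    redirect-realizes : ∀ {a a′ b} → MatRealizes a b M →
      (∀ v → v ≢ i → v ≢ j → lookup a′ v ≡ lookup a v) →
      lookup a′ i + #up (labels M) ≡ lookup a i + #up w →
      lookup a′ j + #down (labels M) ≡ lookup a j + #down w →
      MatRealizes a′ b (redirect w M)
    redirect-realizes {a} {a′} r other at-i at-j = record
      { loopless = loopless′ ; indegree = indegree′ ; outdegree = outdegree′ }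
      where
      open MatRealizes r
      loopless′ : ∀ v → redirect w M v v ≡ false
      loopless′ v with position v
      ... | is-i refl = trans (proj₁ (redirect-rigidRow w M (rigid-letter {w} {M} s i (label-i M)))) (loopless i)
      ... | is-j refl = trans (proj₂ (redirect-rigidRow w M (rigid-letter {w} {M} s j (label-j M)))) (loopless j)
      ... | elsewhere v≢i v≢j = trans (redirect-other w M v v≢i v≢j) (loopless v)
      outdegree′ : ∀ u → sum (λ v → bit (redirect w M u v)) ≡ _
      outdegree′ u = trans (sum-cong-off₂ i≢j (λ v v≢i v≢j → cong bit (redirect-other w M u v≢i v≢j)) (redirect-cell-row u))
                           (outdegree u)
      indegree′ : ∀ v → sum (λ u → bit (redirect w M u v)) ≡ lookup a′ v
      indegree′ v with position v
      ... | is-i refl = +-cancelʳ-≡ _ _ _ (trans column-i (trans (cong (_+ #up w) (indegree i)) (sym at-i)))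
      ... | is-j refl = +-cancelʳ-≡ _ _ _ (trans column-j (trans (cong (_+ #down w) (indegree j)) (sym at-j)))
      ... | elsewhere v≢i v≢j =
        trans (sum-cong-≗ (λ u → cong bit (redirect-other w M u v≢i v≢j))) (trans (indegree v) (sym (other v v≢i v≢j)))

  private
    label-at : ∀ {M₁ M₂} → labels M₁ ≡ labels M₂ → ∀ u → label M₁ u ≡ label M₂ u
    label-at {M₁} {M₂} eqL u = trans (sym (lookup-labels M₁ u)) (trans (cong (λ L → lookup L u) eqL) (lookup-labels M₂ u))

    same-dir : ∀ {M₁ M₂ u} b → label M₁ u ≡ dir b → label M₂ u ≡ dir b → M₁ u i ≡ M₂ u i × M₁ u j ≡ M₂ u j
    same-dir {M₁} {M₂} b ℓ₁ ℓ₂ with _ , _ , ui₁ , uj₁ ← label≡dir M₁ b ℓ₁ | _ , _ , ui₂ , uj₂ ← label≡dir M₂ b ℓ₂ =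
      trans ui₁ (sym ui₂) , trans uj₁ (sym uj₂)

  redirect-rows-injective : ∀ {w₁ w₂ M₁ M₂} → SameRigid w₁ (labels M₁) → SameRigid w₂ (labels M₂) →
    labels M₁ ≡ labels M₂ → redirect w₁ M₁ ≐ redirect w₂ M₂ → ∀ u → M₁ u i ≡ M₂ u i × M₁ u j ≡ M₂ u j
  redirect-rows-injective {w₁} {w₂} {M₁} {M₂} s₁ s₂ eqL eqR u with label M₁ u in ℓ₁
  ... | up = same-dir {M₁} {M₂} {u} true ℓ₁ (trans (sym (label-at eqL u)) ℓ₁)
  ... | down = same-dir {M₁} {M₂} {u} false ℓ₁ (trans (sym (label-at eqL u)) ℓ₁)
  ... | rigid =
    let r₁ᵢ , r₁ⱼ = redirect-rigidRow w₁ M₁ (rigid-letter {w₁} {M₁} s₁ u ℓ₁)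
        r₂ᵢ , r₂ⱼ = redirect-rigidRow w₂ M₂ (rigid-letter {w₂} {M₂} s₂ u (trans (sym (label-at eqL u)) ℓ₁))
    in trans (sym r₁ᵢ) (trans (eqR u i) r₂ᵢ) , trans (sym r₁ⱼ) (trans (eqR u j) r₂ⱼ)

  redirect-injective : ∀ {w₁ w₂ M₁ M₂} → SameRigid w₁ (labels M₁) → SameRigid w₂ (labels M₂) →
                       labels M₁ ≡ labels M₂ → redirect w₁ M₁ ≐ redirect w₂ M₂ → M₁ ≐ M₂
  redirect-injective {w₁} {w₂} {M₁} {M₂} s₁ s₂ eqL eqR u v with position v
  ... | elsewhere v≢i v≢j = trans (sym (redirect-other w₁ M₁ u v≢i v≢j)) (trans (eqR u v) (redirect-other w₂ M₂ u v≢i v≢j))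
  ... | is-i refl = proj₁ (redirect-rows-injective s₁ s₂ eqL eqR u)
  ... | is-j refl = proj₂ (redirect-rows-injective s₁ s₂ eqL eqR u)

-- Counting through injections

module _ {A : Set} where

  ∈-─ : ∀ {x z : A} {ys} (p : x ∈ ys) → z ∈ ys → z ≢ x → z ∈ (ys ─ p)
  ∈-─ (here refl) (here refl) z≢x = ⊥-elim (z≢x refl)
  ∈-─ (here refl) (there q) z≢x = q
  ∈-─ (there p) (here e) z≢x = here e
  ∈-─ (there p) (there q) z≢x = there (∈-─ p q z≢x)

  unique-⊆⇒length≤ : ∀ {xs ys : List A} → Unique xs → (∀ {z} → z ∈ xs → z ∈ ys) → length xs ≤ length ys
  unique-⊆⇒length≤ {[]} u sub = z≤n
  unique-⊆⇒length≤ {x ∷ xs} {ys} (x∉xs ∷ u) sub = subst (suc (length xs) ≤_) (sym (length-removeAt′ ys _))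
    (s≤s (unique-⊆⇒length≤ u (λ q → ∈-─ (sub (here refl)) (sub (there q)) (λ e → All-lookup x∉xs q (sym e)))))

  unique-⊂⇒length< : ∀ {xs ys : List A} → Unique xs → (∀ {z} → z ∈ xs → z ∈ ys) →
                     ∀ {y} → y ∈ ys → y ∉ xs → length ys > length xs
  unique-⊂⇒length< {[]} {_ ∷ _} u sub y∈ys y∉xs = s≤s z≤n
  unique-⊂⇒length< {x ∷ xs} {ys} (x∉xs ∷ u) sub y∈ys y∉xs = subst (_> suc (length xs)) (sym (length-removeAt′ ys _))
    (s≤s (unique-⊂⇒length< u (λ q → ∈-─ (sub (here refl)) (sub (there q)) (λ e → All-lookup x∉xs q (sym e)))
           (∈-─ (sub (here refl)) y∈ys (λ e → y∉xs (here e))) (λ q → y∉xs (there q))))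

  unique-map : ∀ {P : A → Set} (f : A → A) {xs : List A} → Unique xs → All P xs →
               (∀ {x y} → P x → P y → f x ≡ f y → x ≡ y) → Unique (map f xs)
  unique-map f {[]} u ps inj = []
  unique-map f {x ∷ xs} (x∉xs ∷ u) (px ∷ ps) inj = All-map⁺ (distinct x∉xs ps) ∷ unique-map f u ps inj
    where
    distinct : ∀ {zs} → All (x ≢_) zs → All _ zs → All (λ z → f x ≢ f z) zs
    distinct [] [] = []
    distinct (x≢z ∷ ns) (pz ∷ pzs) = (λ e → x≢z (inj px pz e)) ∷ distinct ns pzs

  module Injection {P Q : Pred A 0ℓ} (P? : Decidable P) (Q? : Decidable Q)
           {xs : List A} (unique : Unique xs) (complete : ∀ x → x ∈ xs)
           (f : A → A) (f-maps : ∀ {x} → P x → Q (f x)) (f-inj : ∀ {x y} → P x → P y → f x ≡ f y → x ≡ y) where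

    private
      image : List A
      image = map f (filter P? xs)

      image-unique : Unique image
      image-unique = unique-map f (Unique.filter⁺ P? unique) (all-filter P? xs) f-inj

      image⊆ : ∀ {z} → z ∈ image → z ∈ filter Q? xs
      image⊆ q with x , x∈ , refl ← ∈-map⁻ f q = ∈-filter⁺ Q? (complete (f x)) (f-maps (All-lookup (all-filter P? xs) x∈))

    count-≤ : length (filter P? xs) ≤ length (filter Q? xs)
    count-≤ = subst (_≤ length (filter Q? xs)) (length-map f (filter P? xs)) (unique-⊆⇒length≤ image-unique image⊆)

    count-< : ∀ y → Q y → (∀ {x} → P x → f x ≢ y) → length (filter Q? xs) > length (filter P? xs)
    count-< y qy y∉f = subst (length (filter Q? xs) >_) (length-map f (filter P? xs))
      (unique-⊂⇒length< image-unique image⊆ (∈-filter⁺ Q? (complete y) qy) y∉image)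
      where
      y∉image : y ∉ image
      y∉image q with x , x∈ , e ← ∈-map⁻ f q = y∉f (All-lookup (all-filter P? xs) x∈) (sym e)

  allVecs-unique : ∀ {xs : List A} → Unique xs → ∀ m → Unique (allVecs xs m)
  allVecs-unique u zero = [] ∷ []
  allVecs-unique {xs} u (suc m) = go u
    where
    ∷-injectiveʳ : ∀ {x} {s t : Vec A m} → x ∷ s ≡ x ∷ t → s ≡ t
    ∷-injectiveʳ refl = refl
    go : ∀ {ys} → Unique ys → Unique (concatMap (λ x → map (x ∷_) (allVecs xs m)) ys)
    go {[]} _ = []
    go {y ∷ ys} (y∉ys ∷ u′) = Unique.++⁺ (Unique.map⁺ ∷-injectiveʳ (allVecs-unique u m)) (go u′) disjoint
      where
      disjoint : ∀ {v} → ¬ (v ∈ map (y ∷_) (allVecs xs m) × v ∈ concatMap (λ x → map (x ∷_) (allVecs xs m)) ys)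
      disjoint (p , q) with _ , _ , refl ← ∈-map⁻ (y ∷_) p =
        All-lookup y∉ys (Any.map (λ r → head≡ (∈-map⁻ _ r)) (∈-concatMap⁻ _ q)) refl
        where
        head≡ : ∀ {x t} → ∃[ t′ ] t′ ∈ allVecs xs m × y ∷ t ≡ x ∷ t′ → y ≡ x
        head≡ (_ , _ , refl) = refl

  allVecs-complete : ∀ {xs : List A} → (∀ x → x ∈ xs) → ∀ m (v : Vec A m) → v ∈ allVecs xs m
  allVecs-complete c zero [] = here refl
  allVecs-complete c (suc m) (x ∷ v) =
    ∈-concatMap⁺ _ (Any.map (λ { refl → ∈-map⁺ (x ∷_) (allVecs-complete c m v) }) (c x))

allDigraphs-unique : ∀ n → Unique (allDigraphs n)
allDigraphs-unique n = allVecs-unique (allVecs-unique bools-unique n) n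
  where
  bools-unique : Unique (true ∷ false ∷ [])
  bools-unique = ((λ ()) ∷ []) ∷ [] ∷ []

allDigraphs-complete : ∀ n (D : Digraph n) → D ∈ allDigraphs n
allDigraphs-complete n = allVecs-complete (allVecs-complete bool∈ n) n
  where
  bool∈ : ∀ x → x ∈ true ∷ false ∷ []
  bool∈ true = here refl
  bool∈ false = there (here refl)

≥lex-trans : Transitive _≥lex_
≥lex-trans (inj₁ p>q) (inj₁ q>r) = inj₁ (<-trans q>r p>q)
≥lex-trans (inj₁ p>q) (inj₂ (refl , _)) = inj₁ p>q
≥lex-trans (inj₂ (refl , _)) (inj₁ q>r) = inj₁ q>r
≥lex-trans (inj₂ (refl , p≥q)) (inj₂ (refl , q≥r)) = inj₂ (refl , ≤-trans q≥r p≥q)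

linked-lookup : ∀ {A : Set} {R : A → A → Set} → Transitive R → ∀ {n} (v : Vec A n) → Linked R (toList v) →
                ∀ {i j : Fin n} → i < j → R (lookup v i) (lookup v j)
linked-lookup R-trans (x ∷ y ∷ v) (r ∷ l) {fzero} {fsuc fzero} _ = r
linked-lookup R-trans (x ∷ y ∷ v) (r ∷ l) {fzero} {fsuc (fsuc j)} _ =
  R-trans r (linked-lookup R-trans (y ∷ v) l {fzero} {fsuc j} (s≤s z≤n))
linked-lookup R-trans (x ∷ y ∷ v) (r ∷ l) {fsuc i} {fsuc j} (s≤s i<j) = linked-lookup R-trans (y ∷ v) l i<j

lexNonincreasing-tie : ∀ {n} {a b : Vec ℕ n} → LexNonincreasing a b → ∀ {i j} → i < j →
                       lookup a i ≡ lookup a j → lookup b j ≤ lookup b i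
lexNonincreasing-tie {a = a} {b} lex {i} {j} i<j aᵢ≡aⱼ
  with subst₂ _≥lex_ (lookup-zip i a b) (lookup-zip j a b) (linked-lookup ≥lex-trans (zip a b) lex i<j)
... | inj₁ aᵢ>aⱼ = ⊥-elim (<-irrefl (sym aᵢ≡aⱼ) aᵢ>aⱼ)
... | inj₂ (_ , bᵢ≥bⱼ) = bᵢ≥bⱼ

-- The injection for a unit transfer

module Transfer {n} (i j : Fin n) (i≢j : i ≢ j) (a′ b : Vec ℕ n) (gap : lookup a′ i ≥ lookup a′ j + 2) where

  open Relabelling i j i≢j

  a : Vec ℕ n
  a = transfer i j a′

  private
    a′ᵢ≥1 : 1 ≤ lookup a′ i
    a′ᵢ≥1 = ≤-trans (s≤s z≤n) (≤-trans (m≤n+m 2 (lookup a′ j)) gap)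

    aᵢ+suc : ∀ k → lookup a i + suc k ≡ lookup a′ i + k
    aᵢ+suc k = trans (cong (_+ suc k) (lookup-transfer-source i≢j a′)) (∸1+suc a′ᵢ≥1)
      where
      ∸1+suc : ∀ {x} → 1 ≤ x → x ∸ 1 + suc k ≡ x + k
      ∸1+suc {suc x} _ = +-suc x k

    aⱼ : lookup a j ≡ suc (lookup a′ j)
    aⱼ = lookup-transfer-target i≢j a′

  shift-defined : ∀ {M} → MatRealizes a′ b M → ∃[ w ] shift 0 (labels M) ≡ just w
  shift-defined {M} r = shift-just 0 (labels M)
    (subst (#up (labels M) >_) (sym (+-identityʳ _)) (gap⇒more-ups (indegree-balance r) gap (bit≤1 (M j i))))
    where
    gap⇒more-ups : ∀ {A B x y p q} → A + x + p ≡ B + y + q → B + 2 ≤ A → y ≤ 1 → q > p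
    gap⇒more-ups {A} {B} {x} {y} {p} {q} e B+2≤A y≤1 = +-cancelˡ-≤ (B + 1) (suc p) q (begin
      B + 1 + suc p  ≡⟨ trans (+-suc (B + 1) p) (cong (_+ p) (sym (+-suc B 1))) ⟩
      B + 2 + p      ≤⟨ +-monoˡ-≤ p (≤-trans B+2≤A (m≤m+n A x)) ⟩
      A + x + p      ≡⟨ e ⟩
      B + y + q      ≤⟨ +-monoˡ-≤ q (+-monoʳ-≤ B y≤1) ⟩
      B + 1 + q      ∎)
      where open ≤-Reasoning

  private
    shift-rigid : ∀ {M w} → shift 0 (labels M) ≡ just w → SameRigid w (labels M)
    shift-rigid {M} {w} eq = proj₁ (shift-counts 0 (labels M) w eq)

  shifted-realizes : ∀ {M w} → MatRealizes a′ b M → shift 0 (labels M) ≡ just w → MatRealizes a b (redirect w M)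
  shifted-realizes {M} {w} r eq =
    let s , #up≡ , #down≡ = shift-counts 0 (labels M) w eq in
    redirect-realizes s r (lookup-transfer-other i≢j a′)
      (trans (cong (lookup a i +_) (sym #up≡)) (aᵢ+suc (#up w)))
      (trans (cong (_+ #down (labels M)) aⱼ) (trans (sym (+-suc _ _)) (cong (lookup a′ j +_) (sym #down≡))))

  -- Junk value: a digraph whose labels cannot be shifted is returned unchanged; by shift-defined this never
  -- happens on realizations of (a′, b).
  shiftDigraph : Digraph n → Digraph n
  shiftDigraph D = maybe′ (λ w → toDigraph (redirect w (arc D))) D (shift 0 (labels (arc D)))

  shiftDigraph-spec : ∀ {D} → Realizes a′ b D →
    ∃[ w ] shift 0 (labels (arc D)) ≡ just w × shiftDigraph D ≡ toDigraph (redirect w (arc D))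
  shiftDigraph-spec {D} r =
    let w , eq = shift-defined (realizes⇒matRealizes {D = D} r) in
    w , eq , cong (maybe′ (λ w → toDigraph (redirect w (arc D))) D) eq

  shiftDigraph-realizes : ∀ {D} → Realizes a′ b D → Realizes a b (shiftDigraph D)
  shiftDigraph-realizes {D} r =
    let w , eq , F≡ = shiftDigraph-spec {D} r in
    subst (Realizes a b) (sym F≡) (matRealizes⇒realizes (shifted-realizes (realizes⇒matRealizes {D = D} r) eq))

  labels-shiftDigraph : ∀ {D} → Realizes a′ b D → shift 0 (labels (arc D)) ≡ just (labels (arc (shiftDigraph D)))
  labels-shiftDigraph {D} r =
    let w , eq , F≡ = shiftDigraph-spec {D} r in
    trans eq (cong just (sym (begin
      labels (arc (shiftDigraph D))                   ≡⟨ cong (labels ∘ arc) F≡ ⟩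
      labels (arc (toDigraph (redirect w (arc D))))   ≡⟨ labels-cong (arc-toDigraph _) ⟩
      labels (redirect w (arc D))                     ≡⟨ labels-redirect (shift-rigid eq) ⟩
      w                                               ∎)))
    where open ≡-Reasoning

  shiftDigraph-injective : ∀ {D₁ D₂} → Realizes a′ b D₁ → Realizes a′ b D₂ → shiftDigraph D₁ ≡ shiftDigraph D₂ → D₁ ≡ D₂
  shiftDigraph-injective {D₁} {D₂} r₁ r₂ F≡F =
    let w₁ , eq₁ , F₁ = shiftDigraph-spec {D₁} r₁
        w₂ , eq₂ , F₂ = shiftDigraph-spec {D₂} r₂
        same-redirect : redirect w₁ (arc D₁) ≐ redirect w₂ (arc D₂)
        same-redirect u v = trans (sym (arc-toDigraph _ u v))
                                  (trans (cong (λ D → arc D u v) (trans (sym F₁) (trans F≡F F₂))) (arc-toDigraph _ u v))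
    in digraph-ext (redirect-injective (shift-rigid eq₁) (shift-rigid eq₂) same-labels same-redirect)
    where
    same-labels : labels (arc D₁) ≡ labels (arc D₂)
    same-labels = shift-injective 0 (labels-shiftDigraph {D₁} r₁)
                    (trans (labels-shiftDigraph {D₂} r₂) (cong (just ∘ labels ∘ arc) (sym F≡F)))

  shiftDigraph-¬ballot : ∀ {D} → Realizes a′ b D → ¬ Ballot (labels (arc (shiftDigraph D)))
  shiftDigraph-¬ballot {D} r = shift-¬ballot 0 (labels (arc D)) _ (labels-shiftDigraph {D} r)

  missed-realization : ∀ {E} → MatRealizes a b E → #down (labels E) ≤ #up (labels E) →
    ∃[ D′ ] Realizes a b D′ × (∀ {D} → Realizes a′ b D → shiftDigraph D ≢ D′)
  missed-realization {E} r le =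
    let v , s , #down≡ , #up≡ , ballot = ballot-rearrangement (labels E) le
        labels-of : ∀ {D} → D ≡ toDigraph (redirect v E) → labels (arc D) ≡ v
        labels-of = λ { refl → trans (labels-cong (arc-toDigraph _)) (labels-redirect s) }
    in toDigraph (redirect v E) ,
       matRealizes⇒realizes (redirect-realizes s {a = a} {a′ = a} r (λ _ _ _ → refl)
                                (cong (lookup a i +_) (sym #up≡)) (cong (lookup a j +_) (sym #down≡))) ,
       λ {D} rD F≡ → shiftDigraph-¬ballot {D} rD (subst Ballot (sym (labels-of F≡)) ballot)

  balanced : ∀ {E} → MatRealizes a b E → lookup a j + bit (E j i) ≤ lookup a i + bit (E i j) →
             #down (labels E) ≤ #up (labels E)
  balanced r h = +-cancelˡ-≤ _ _ _ (≤-trans (+-monoˡ-≤ _ h) (≤-reflexive (indegree-balance r)))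

  private
    aⱼ≤aᵢ : lookup a j ≤ lookup a i
    aⱼ≤aᵢ = +-cancelʳ-≤ 1 _ _ (begin
      lookup a j + 1        ≡⟨ cong (_+ 1) aⱼ ⟩
      suc (lookup a′ j) + 1 ≡⟨ +-suc (lookup a′ j) 1 ⟨
      lookup a′ j + 2       ≤⟨ gap ⟩
      lookup a′ i           ≡⟨ trans (aᵢ+suc 0) (+-identityʳ _) ⟨
      lookup a i + 1        ∎)
      where open ≤-Reasoning

    bits-tight : ∀ {x y} p q → y ≤ x → ¬ (y + bit q ≤ x + bit p) → p ≡ false × q ≡ true × x ≡ y
    bits-tight true q y≤x ¬ok = ⊥-elim (¬ok (+-mono-≤ y≤x (bit≤1 q)))
    bits-tight false false y≤x ¬ok = ⊥-elim (¬ok (+-monoˡ-≤ 0 y≤x))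
    bits-tight {x} {y} false true y≤x ¬ok =
      refl , refl , ≤-antisym (+-cancelʳ-≤ 1 x y (≤-trans (≤-reflexive (+-suc x 0)) (≰⇒> ¬ok))) y≤x

  -- Trade the arcs j → i and i → x for j → x and i → j, where x is an out-neighbour of i but not of j.
  traded-realization : ∀ {M} → MatRealizes a′ b M → M j i ≡ true → M i j ≡ false →
    lookup a i ≡ lookup a j → lookup b j ≤ lookup b i → ∃[ E ] MatRealizes a b E × #down (labels E) ≤ #up (labels E)
  traded-realization {M} r ji ij aᵢ≡aⱼ bⱼ≤bᵢ =
    let x , ix , jx = sum-bit-≤⇒∃ (M i) (M j) (loopless i) ji
                        (subst₂ _≤_ (sym (outdegree j)) (sym (outdegree i)) bⱼ≤bᵢ)
        x≢i : x ≢ i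
        x≢i = λ x≡i → case trans (sym ix) (trans (cong (M i) x≡i) (loopless i)) of λ ()
        x≢j : x ≢ j
        x≢j = λ x≡j → case trans (sym ix) (trans (cong (M i) x≡j) ij) of λ ()
        E = moveArc i x j (moveArc j i x M)
        r₁ : MatRealizes (transfer i x a′) b (moveArc j i x M)
        r₁ = moveArc-realizes r ji jx (x≢j ∘ sym)
        r₂ : MatRealizes (transfer x j (transfer i x a′)) b E
        r₂ = moveArc-realizes r₁ (trans (moveArc-otherRow x i≢j) ix) (trans (moveArc-otherRow j i≢j) ij) i≢j
        rE : MatRealizes a b E
        rE = MatRealizes-cong (transfer-trans (x≢i ∘ sym) x≢j i≢j a′) r₂
        Eij : E i j ≡ true
        Eij = moveArc-target {u = i} {x} {j} {moveArc j i x M}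
    in E , rE , balanced rE (subst (λ e → lookup a j + bit (E j i) ≤ lookup a i + bit e) (sym Eij)
                               (subst (λ z → lookup a j + bit (E j i) ≤ z + 1) (sym aᵢ≡aⱼ) (+-monoʳ-≤ (lookup a j) (bit≤1 _))))
    where open MatRealizes r

  balanced-realization : ∀ {M} → (lookup a i ≡ lookup a j → lookup b j ≤ lookup b i) → MatRealizes a′ b M →
    ∃[ E ] MatRealizes a b E × #down (labels E) ≤ #up (labels E)
  balanced-realization {M} tie r with lookup a j + bit (M j i) ≤? lookup a i + bit (M i j)
  ... | yes ok =
    let w , eq = shift-defined r
        rE = shifted-realizes r eq
    in redirect w M , rE , balanced rE (subst₂ (λ x y → lookup a j + bit x ≤ lookup a i + bit y)
                                               (sym (redirect-ji (shift-rigid eq))) (sym (redirect-ij (shift-rigid eq))) ok)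
  ... | no ¬ok =
    let ij , ji , aᵢ≡aⱼ = bits-tight (M i j) (M j i) aⱼ≤aᵢ ¬ok in
    traded-realization r ji ij aᵢ≡aⱼ (tie aᵢ≡aⱼ)

theorem13 : (n : ℕ) (a a' b : Vec ℕ n) (i j : Fin n) →
    LexNonincreasing a b →
    i < j →
    lookup a' i ≥ lookup a' j + 2 →
    a ≡ transfer i j a' →
    (N₂ a b ≥ N₂ a' b) × (Digraphic a' b → N₂ a b > N₂ a' b)
theorem13 n .(transfer i j a′) a′ b i j lex i<j gap refl = count-≤ , strict
  where
  open Transfer i j (Fin.<⇒≢ i<j) a′ b gap
  open Injection (realizes? a′ b) (realizes? a b) (allDigraphs-unique n) (allDigraphs-complete n)
                 shiftDigraph (λ {D} → shiftDigraph-realizes {D}) (λ {D₁} {D₂} → shiftDigraph-injective {D₁} {D₂})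
  strict : Digraphic a′ b → N₂ a b > N₂ a′ b
  strict (D , rD) =
    let E , rE , balancedE = balanced-realization (lexNonincreasing-tie lex i<j) (realizes⇒matRealizes {D = D} rD)
        D′ , rD′ , missed = missed-realization rE balancedE
    in count-< D′ rD′ missed
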